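{- Let $p$ be a prime, $q=p^m$ and $n$ positive integers. Let $\phi(x)=\sum_i a_i x^{q^i}$ with all $a_i\in\mathbb{F}_q$ (an $\mathbb{F}_q$-linear polynomial over $\mathbb{F}_q$), viewed as an endomorphism of $\mathbb{F}_{q^n}$, let $g\in\mathbb{F}_{q^n}[x]$ and $b\in\mathbb{F}_q^*$. Put $$f_1(x)=b\phi(x)+\mathrm{Tr}_q^{q^n}\big(g(x^q-x)\big),\qquad f_2(x)=b\phi(x)+g(x^q-x)^{(q^n-1)/(q-1)}.$$ If $f_1$ (respectively $f_2$) is a permutation polynomial of $\mathbb{F}_{q^n}$, then $f_1$ (respectively $f_2$) is PcN over $\mathbb{F}_{q^n}$ for every $c\in\mathbb{F}_q\setminus\{1\}$.
   Context: $\mathrm{Tr}_q^{q^n}(y)=\sum_{i=0}^{n-1}y^{q^i}$ is the relative trace. For $f:\mathbb{F}_{Q}\to\mathbb{F}_{Q}$ and $c\in\mathbb{F}_Q$, ${}_c\Delta_f(a,b)=\#\{x\in\mathbb{F}_Q: f(x+a)-cf(x)=b\}$ and ${}_c\Delta_f=\max\{{}_c\Delta_f(a,b): a,b\in\mathbb{F}_Q,\ (a,c)\neq(0,1)\}$; $f$ is PcN if ${}_c\Delta_f\le 1$. -}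

module Defs where

open import Level using (0ℓ)
open import Data.Nat as ℕ using (ℕ; zero; suc; _⊔_)
open import Data.List using (List; []; _∷_; length; filter; foldr; concatMap; map)
open import Data.List.Membership.Propositional using (_∈_)
open import Data.List.Relation.Unary.Unique.Propositional using (Unique)
open import Data.Product using (∃; _×_; _,_)
open import Data.Sum using (_⊎_)
open import Relation.Nullary using (¬_; Dec; yes; no)
open import Relation.Nullary.Decidable using (_×-dec_; ¬?)
open import Relation.Binary.PropositionalEquality using (_≡_; _≢_)
open import Relation.Binary.Definitions using (DecidableEquality)
open import Algebra.Structures using (IsCommutativeRing)

record FiniteField : Set₁ where
  infixl 6 _+_ _-_
  infixl 7 _*_
  infixr 8 _^ᶠ_
  field
    Carrier : Set
    _+_ _*_ : Carrier → Carrier → Carrier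
    -_ : Carrier → Carrier
    0# 1# : Carrier
    isCommutativeRing : IsCommutativeRing _≡_ _+_ _*_ -_ 0# 1#
    0≢1 : 0# ≢ 1#
    inverse : ∀ x → x ≢ 0# → ∃ λ y → x * y ≡ 1#
    _≟_ : DecidableEquality Carrier
    elements : List Carrier
    complete : ∀ x → x ∈ elements
    unique : Unique elements

  _-_ : Carrier → Carrier → Carrier
  x - y = x + (- y)

  _^ᶠ_ : Carrier → ℕ → Carrier
  x ^ᶠ zero = 1#
  x ^ᶠ suc k = x * (x ^ᶠ k)

  card : ℕ
  card = length elements

  Tr : (q n : ℕ) → Carrier → Carrier
  Tr q zero y = 0#
  Tr q (suc i) y = Tr q i y + y ^ᶠ (q ℕ.^ i)

  linEvalFrom : (q start : ℕ) → List Carrier → Carrier → Carrier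
  linEvalFrom q i [] x = 0#
  linEvalFrom q i (a ∷ as) x = a * x ^ᶠ (q ℕ.^ i) + linEvalFrom q (suc i) as x

  linEval : ℕ → List Carrier → Carrier → Carrier
  linEval q a x = linEvalFrom q 0 a x

  polyEvalFrom : ℕ → List Carrier → Carrier → Carrier
  polyEvalFrom i [] x = 0#
  polyEvalFrom i (c ∷ cs) x = c * x ^ᶠ i + polyEvalFrom (suc i) cs x

  polyEval : List Carrier → Carrier → Carrier
  polyEval cs x = polyEvalFrom 0 cs x

  InSubfield : ℕ → Carrier → Set
  InSubfield q x = x ^ᶠ q ≡ x

  cΔ : (Carrier → Carrier) → Carrier → Carrier → Carrier → ℕ
  cΔ f c a b = length (filter (λ x → (f (x + a) - c * f x) ≟ b) elements)

  -- ${}_c\Delta_f = max over (a,b) with (a,c) ≠ (0,1) of cΔ_f(a,b)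
  rowValues : (Carrier → Carrier) → Carrier → Carrier → List ℕ
  rowValues f c a with ¬? ((a ≟ 0#) ×-dec (c ≟ 1#))
  ... | yes _ = map (λ b → cΔ f c a b) elements
  ... | no _ = []

  cDU : (Carrier → Carrier) → Carrier → ℕ
  cDU f c = foldr _⊔_ 0 (concatMap (rowValues f c) elements)

  PcN : (Carrier → Carrier) → Carrier → Set
  PcN f c = cDU f c ℕ.≤ 1

-- Both have the shape f = b·φ + H with H valued in 𝔽_q (H^q = H) and invariant
-- under translations by 𝔽_q.  Put L(z) = z^q − z, an 𝔽_q-linear map with kernel 𝔽_q.
-- Then L∘f = L∘(bφ) is additive, so two solutions x, y of f(x+a) − c·f(x) = β satisfy
-- (1−c)·L(f x) = (1−c)·L(f y), i.e. D = f x − f y ∈ 𝔽_q.  Since f(u+t) = f(u) + t·s for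
-- t ∈ 𝔽_q, with s = bφ(1) ∈ 𝔽_q^*, injectivity gives x = y + D/s, and substituting
-- back yields (1−c)·D = 0; so D = 0 and x = y.  At most one solution means PcN.
module Submission where

open import Defs
open import Data.Nat as ℕ using (ℕ; _≥_; _^_)
open import Data.Nat.Primality using (Prime)
open import Data.List using (List)
open import Data.List.Relation.Unary.All using (All)
open import Data.Product using (_×_)
open import Relation.Binary.PropositionalEquality using (_≡_; _≢_)
open import Function.Definitions using (Bijective)

open import Level using (0ℓ)
open import Data.Nat using (zero; suc; _∸_; _<_; _≤_; _⊔_; _!; z≤n; s≤s; nonTrivial⇒≢1)
import Data.Nat.Properties as ℕP
open import Data.Nat.Divisibility using (_∣_; divides; m∣m*n; ∣⇒≤; ∣1⇒≡1)
open import Data.Nat.DivMod using (m/n*n≡m)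
open import Data.Nat.Primality using (euclidsLemma; prime⇒nonTrivial; prime⇒nonZero)
open import Data.Nat.Combinatorics using (_C_; nCn≡1; nCk≡nC[n∸k]; nCk≡n!/k![n-k]!; k![n∸k]!∣n!)
open import Data.List using ([]; _∷_; length; filter; foldr; map; concatMap)
open import Data.List.Properties using (filter-all)
open import Data.List.Membership.Propositional using (_∈_)
open import Data.List.Membership.Propositional.Properties using (∈-map⁺; ∈-map⁻; ∈-filter⁺; ∈-filter⁻)
open import Data.List.Membership.Propositional.Properties.WithK using (unique∧set⇒bag)
open import Data.List.Relation.Binary.BagAndSetEquality using (∼bag⇒↭)
open import Data.List.Relation.Binary.Permutation.Propositional using (_↭_; ↭⇒↭ₛ)
open import Data.List.Relation.Binary.Permutation.Setoid.Properties using (foldr-commMonoid)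
open import Data.List.Relation.Unary.All as All using ([]; _∷_)
import Data.List.Relation.Unary.All.Properties as AllP
open import Data.List.Relation.Unary.Any using (here; there)
open import Data.List.Relation.Unary.AllPairs using (_∷_)
open import Data.List.Relation.Unary.Unique.Propositional using (Unique)
import Data.List.Relation.Unary.Unique.Propositional.Properties as UniqueP
open import Data.Fin using (Fin; toℕ; fromℕ; inject₁)
import Data.Fin as Fin
open import Data.Fin.Properties using (toℕ-fromℕ; toℕ-inject₁; toℕ<n)
open import Data.Vec.Functional using (replicate)
open import Data.Product using (_,_; proj₁; proj₂)
open import Data.Sum using (_⊎_; inj₁; inj₂)
open import Data.Empty using (⊥; ⊥-elim)
open import Data.Maybe using (nothing)
open import Relation.Nullary using (¬_; Dec; yes; no)
open import Relation.Nullary.Decidable using (_×-dec_; ¬?)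
open import Relation.Binary.PropositionalEquality using (refl; sym; trans; cong; cong₂; subst; setoid; module ≡-Reasoning)
open import Algebra.Bundles using (CommutativeRing)
open import Algebra.Structures using (IsCommutativeRing)
open import Function.Bundles using (mk⇔)
open import Tactic.RingSolver.Core.AlmostCommutativeRing using (fromCommutativeRing)

-- A prime p divides no factorial j! with j < p (Euclid's lemma applied to j! = j·(j−1)!).
prime∤factorial : ∀ {p} → Prime p → ∀ j → j < p → ¬ (p ∣ j !)
prime∤factorial pr zero _ p∣1 = nonTrivial⇒≢1 {{prime⇒nonTrivial pr}} (∣1⇒≡1 p∣1)
prime∤factorial pr (suc j) j<p p∣j! with euclidsLemma (suc j) (j !) pr p∣j!
... | inj₁ p∣1+j = ℕP.<⇒≱ j<p (∣⇒≤ p∣1+j)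
... | inj₂ p∣j!′ = prime∤factorial pr j (ℕP.<-trans (ℕP.n<1+n j) j<p) p∣j!′

-- A prime p divides (p C k) for 0 < k < p: it divides p! = (p C k)·(k!·(p−k)!),
-- but neither k! nor (p−k)!.  This kills the middle binomial terms of (x+y)^p.
prime∣choose : ∀ {p k} → Prime p → 0 < k → k < p → p ∣ (p C k)
prime∣choose {p} {k} pr 0<k k<p with euclidsLemma (p C k) (k ! ℕ.* (p ∸ k) !) pr p∣product
  where
  instance
    k!*[p∸k]!≢0 : ℕ.NonZero (k ! ℕ.* (p ∸ k) !)
    k!*[p∸k]!≢0 = ℕP._!*_!≢0 k (p ∸ k)
  n∣n! : ∀ n → 0 < n → n ∣ n !
  n∣n! (suc n) _ = m∣m*n (n !)
  p∣product : p ∣ (p C k) ℕ.* (k ! ℕ.* (p ∸ k) !)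
  p∣product = subst (p ∣_)
    (sym (trans (cong (ℕ._* (k ! ℕ.* (p ∸ k) !)) (nCk≡n!/k![n-k]! (ℕP.<⇒≤ k<p)))
                (m/n*n≡m (k![n∸k]!∣n! (ℕP.<⇒≤ k<p)))))
    (n∣n! p (ℕP.<-trans 0<k k<p))
... | inj₁ p∣pCk = p∣pCk
... | inj₂ p∣rest with euclidsLemma (k !) ((p ∸ k) !) pr p∣rest
...   | inj₁ p∣k! = ⊥-elim (prime∤factorial pr k k<p p∣k!)
...   | inj₂ p∣[p∸k]! = ⊥-elim (prime∤factorial pr (p ∸ k) (ℕP.∸-monoʳ-< 0<k (ℕP.<⇒≤ k<p)) p∣[p∸k]!)

map-↭-self : ∀ {A : Set} (l : List A) → Unique l → (σ τ : A → A) →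
  (∀ y → τ (σ y) ≡ y) → (∀ z → σ (τ z) ≡ z) →
  (∀ {y} → y ∈ l → σ y ∈ l) → (∀ {z} → z ∈ l → τ z ∈ l) → map σ l ↭ l
map-↭-self l uniq σ τ τσ στ σ-closed τ-closed =
  ∼bag⇒↭ (unique∧set⇒bag (UniqueP.map⁺ σ-injective uniq) uniq (mk⇔ into onto))
  where
  σ-injective : ∀ {x y} → σ x ≡ σ y → x ≡ y
  σ-injective {x} {y} e = trans (sym (τσ x)) (trans (cong τ e) (τσ y))
  into : ∀ {z} → z ∈ map σ l → z ∈ l
  into z∈ with ∈-map⁻ σ z∈
  ... | y , y∈ , refl = σ-closed y∈
  onto : ∀ {z} → z ∈ l → z ∈ map σ l
  onto {z} z∈ = subst (_∈ map σ l) (στ z) (∈-map⁺ σ (τ-closed z∈))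

length≤1 : ∀ {A : Set} (l : List A) → Unique l → (∀ {x y} → x ∈ l → y ∈ l → x ≡ y) → length l ≤ 1
length≤1 [] _ _ = z≤n
length≤1 (x ∷ []) _ _ = s≤s z≤n
length≤1 (x ∷ y ∷ l) ((x≢y ∷ _) ∷ _) all-equal = ⊥-elim (x≢y (all-equal (here refl) (there (here refl))))

module FieldTheory (F : FiniteField) where
  open FiniteField F
  open IsCommutativeRing isCommutativeRing
    using (+-assoc; +-comm; *-assoc; *-comm; +-identityˡ; +-identityʳ; *-identityˡ; *-identityʳ;
           distribˡ; distribʳ; zeroˡ; zeroʳ; -‿inverseˡ; -‿inverseʳ;
           +-isCommutativeMonoid; *-isCommutativeMonoid)
  open ≡-Reasoning

  ring : CommutativeRing 0ℓ 0ℓ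
  ring = record { isCommutativeRing = isCommutativeRing }

  open CommutativeRing ring using (semiring; commutativeSemiring)
  open import Algebra.Properties.Ring (CommutativeRing.ring ring)
    using (x∙y⁻¹≈ε⇒x≈y; +-identityˡ-unique; +-identityʳ-unique; +-cancelʳ; -‿+-comm; -‿distribˡ-*; -‿distribʳ-*; x[y-z]≈xy-xz)
  open import Algebra.Properties.Semiring.Mult semiring using (×-assoc-*; ×1-homo-*) renaming (_×_ to _·_)
  open import Algebra.Properties.Semiring.Exp semiring using (^-homo-*; ^-assocʳ) renaming (_^_ to _^ʳ_)
  open import Algebra.Properties.CommutativeSemiring.Exp commutativeSemiring using (^-distrib-*)
  open import Algebra.Properties.CommutativeSemiring.Binomial commutativeSemiring
    using (binomialTerm) renaming (theorem to binomial-theorem)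
  open import Algebra.Properties.Semiring.Sum semiring using (sum; sum-init-last; sum-cong-≗; sum-replicate-zero)
  open import Tactic.RingSolver.NonReflective (fromCommutativeRing ring (λ _ → nothing))

  x-y≡0⇒x≡y : ∀ x y → x - y ≡ 0# → x ≡ y
  x-y≡0⇒x≡y = x∙y⁻¹≈ε⇒x≈y

  no-zero-divisors : ∀ x y → x * y ≡ 0# → x ≡ 0# ⊎ y ≡ 0#
  no-zero-divisors x y xy≡0 with x ≟ 0#
  ... | yes x≡0 = inj₁ x≡0
  ... | no x≢0 with inverse x x≢0
  ...   | x⁻¹ , xx⁻¹≡1 = inj₂ (begin
    y              ≡⟨ sym (*-identityˡ y) ⟩
    1# * y         ≡⟨ cong (_* y) (trans (sym xx⁻¹≡1) (*-comm x x⁻¹)) ⟩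
    (x⁻¹ * x) * y  ≡⟨ *-assoc x⁻¹ x y ⟩
    x⁻¹ * (x * y)  ≡⟨ cong (x⁻¹ *_) xy≡0 ⟩
    x⁻¹ * 0#       ≡⟨ zeroʳ x⁻¹ ⟩
    0#             ∎)

  *-cancelˡ : ∀ x y z → x ≢ 0# → x * y ≡ x * z → y ≡ z
  *-cancelˡ x y z x≢0 xy≡xz with no-zero-divisors x (y - z) x[y-z]≡0
    where
    x[y-z]≡0 : x * (y - z) ≡ 0#
    x[y-z]≡0 = begin
      x * (y - z)          ≡⟨ distribˡ x y (- z) ⟩
      x * y + x * - z      ≡⟨ cong₂ _+_ xy≡xz (sym (-‿distribʳ-* x z)) ⟩
      x * z - x * z        ≡⟨ -‿inverseʳ (x * z) ⟩
      0#                   ∎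
  ... | inj₁ x≡0 = ⊥-elim (x≢0 x≡0)
  ... | inj₂ y-z≡0 = x-y≡0⇒x≡y y z y-z≡0

  sub-interchange : ∀ a b c d → (a - b) - (c - d) ≡ (a - c) - (b - d)
  sub-interchange = solve 4 (λ a b c d → ((a ⊕ (⊝ b)) ⊕ (⊝ (c ⊕ (⊝ d)))) ⊜ ((a ⊕ (⊝ c)) ⊕ (⊝ (b ⊕ (⊝ d))))) refl

  -- Cancellation of a common summand.  (The ring solver cannot cancel x − x for us,
  -- since coefficient arithmetic over an abstract field does not compute.)
  sub-add : ∀ x y → (x - y) + y ≡ x
  sub-add x y = trans (+-assoc x (- y) y) (trans (cong (x +_) (-‿inverseˡ y)) (+-identityʳ x))

  add-sub-cancelʳ : ∀ x y z → (x + z) - (y + z) ≡ x - y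
  add-sub-cancelʳ x y z = begin
    (x + z) - (y + z)      ≡⟨ cong ((x + z) +_) (sym (-‿+-comm y z)) ⟩
    (x + z) + (- y + - z)  ≡⟨ solve 4 (λ x -y z -z → ((x ⊕ z) ⊕ (-y ⊕ -z)) ⊜ ((x ⊕ -y) ⊕ (z ⊕ -z))) refl x (- y) z (- z) ⟩
    (x - y) + (z - z)      ≡⟨ cong ((x - y) +_) (-‿inverseʳ z) ⟩
    (x - y) + 0#           ≡⟨ +-identityʳ (x - y) ⟩
    x - y                  ∎

  one-minus-zero : ∀ c w → c ≢ 1# → w - c * w ≡ 0# → w ≡ 0#
  one-minus-zero c w c≢1 w-cw≡0 with no-zero-divisors (1# - c) w [1-c]w≡0
    where
    [1-c]w≡0 : (1# - c) * w ≡ 0#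
    [1-c]w≡0 = begin
      (1# - c) * w        ≡⟨ distribʳ w 1# (- c) ⟩
      1# * w + (- c) * w  ≡⟨ cong₂ _+_ (*-identityˡ w) (sym (-‿distribˡ-* c w)) ⟩
      w - c * w           ≡⟨ w-cw≡0 ⟩
      0#                  ∎
  ... | inj₁ 1-c≡0 = ⊥-elim (c≢1 (sym (x-y≡0⇒x≡y 1# c 1-c≡0)))
  ... | inj₂ w≡0 = w≡0

  one-minus-injective : ∀ c w z → c ≢ 1# → w - c * w ≡ z - c * z → w ≡ z
  one-minus-injective c w z c≢1 e = x-y≡0⇒x≡y w z (one-minus-zero c (w - z) c≢1 (begin
    (w - z) - c * (w - z)          ≡⟨ cong (λ v → (w - z) - v) (x[y-z]≈xy-xz c w z) ⟩
    (w - z) - (c * w - c * z)      ≡⟨ sub-interchange w z (c * w) (c * z) ⟩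
    (w - c * w) - (z - c * z)      ≡⟨ cong (_- (z - c * z)) e ⟩
    (z - c * z) - (z - c * z)      ≡⟨ -‿inverseʳ _ ⟩
    0#                             ∎))

  ^ᶠ≡^ʳ : ∀ x k → x ^ᶠ k ≡ x ^ʳ k
  ^ᶠ≡^ʳ x zero = refl
  ^ᶠ≡^ʳ x (suc k) = cong (x *_) (^ᶠ≡^ʳ x k)

  ^ᶠ-+ : ∀ x i j → x ^ᶠ (i ℕ.+ j) ≡ x ^ᶠ i * x ^ᶠ j
  ^ᶠ-+ x i j = begin
    x ^ᶠ (i ℕ.+ j)     ≡⟨ ^ᶠ≡^ʳ x (i ℕ.+ j) ⟩
    x ^ʳ (i ℕ.+ j)     ≡⟨ ^-homo-* x i j ⟩
    x ^ʳ i * x ^ʳ j    ≡⟨ sym (cong₂ _*_ (^ᶠ≡^ʳ x i) (^ᶠ≡^ʳ x j)) ⟩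
    x ^ᶠ i * x ^ᶠ j    ∎

  ^ᶠ-* : ∀ x i j → x ^ᶠ (i ℕ.* j) ≡ (x ^ᶠ i) ^ᶠ j
  ^ᶠ-* x i j = begin
    x ^ᶠ (i ℕ.* j)     ≡⟨ ^ᶠ≡^ʳ x (i ℕ.* j) ⟩
    x ^ʳ (i ℕ.* j)     ≡⟨ sym (^-assocʳ x i j) ⟩
    (x ^ʳ i) ^ʳ j      ≡⟨ sym (trans (^ᶠ≡^ʳ (x ^ᶠ i) j) (cong (_^ʳ j) (^ᶠ≡^ʳ x i))) ⟩
    (x ^ᶠ i) ^ᶠ j      ∎

  *-^ᶠ : ∀ x y k → (x * y) ^ᶠ k ≡ x ^ᶠ k * y ^ᶠ k
  *-^ᶠ x y k = begin
    (x * y) ^ᶠ k       ≡⟨ ^ᶠ≡^ʳ (x * y) k ⟩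
    (x * y) ^ʳ k       ≡⟨ ^-distrib-* x y k ⟩
    x ^ʳ k * y ^ʳ k    ≡⟨ sym (cong₂ _*_ (^ᶠ≡^ʳ x k) (^ᶠ≡^ʳ y k)) ⟩
    x ^ᶠ k * y ^ᶠ k    ∎

  1^ᶠ : ∀ k → 1# ^ᶠ k ≡ 1#
  1^ᶠ zero = refl
  1^ᶠ (suc k) = trans (*-identityˡ _) (1^ᶠ k)

  ^ᶠ≡0⇒≡0 : ∀ x k → x ^ᶠ k ≡ 0# → x ≡ 0#
  ^ᶠ≡0⇒≡0 x zero 1≡0 = ⊥-elim (0≢1 (sym 1≡0))
  ^ᶠ≡0⇒≡0 x (suc k) x^[1+k]≡0 with no-zero-divisors x (x ^ᶠ k) x^[1+k]≡0
  ... | inj₁ x≡0 = x≡0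
  ... | inj₂ x^k≡0 = ^ᶠ≡0⇒≡0 x k x^k≡0

  InSubfield-1 : ∀ q → InSubfield q 1#
  InSubfield-1 = 1^ᶠ

  InSubfield-* : ∀ {q x y} → InSubfield q x → InSubfield q y → InSubfield q (x * y)
  InSubfield-* {q} {x} {y} x^q≡x y^q≡y = trans (*-^ᶠ x y q) (cong₂ _*_ x^q≡x y^q≡y)

  InSubfield-inverse : ∀ {q x y} → InSubfield q x → x * y ≡ 1# → InSubfield q y
  InSubfield-inverse {q} {x} {y} x^q≡x xy≡1 = *-cancelˡ x (y ^ᶠ q) y x≢0 (begin
    x * y ^ᶠ q        ≡⟨ cong (_* y ^ᶠ q) (sym x^q≡x) ⟩
    x ^ᶠ q * y ^ᶠ q   ≡⟨ sym (*-^ᶠ x y q) ⟩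
    (x * y) ^ᶠ q      ≡⟨ cong (_^ᶠ q) xy≡1 ⟩
    1# ^ᶠ q           ≡⟨ 1^ᶠ q ⟩
    1#                ≡⟨ sym xy≡1 ⟩
    x * y             ∎)
    where
    x≢0 : x ≢ 0#
    x≢0 x≡0 = 0≢1 (trans (sym (zeroˡ y)) (trans (cong (_* y) (sym x≡0)) xy≡1))

  InSubfield-^q^i : ∀ {q t} → InSubfield q t → ∀ i → t ^ᶠ (q ^ i) ≡ t
  InSubfield-^q^i t^q≡t zero = *-identityʳ _
  InSubfield-^q^i {q} {t} t^q≡t (suc i) =
    trans (^ᶠ-* t q (q ^ i)) (trans (cong (_^ᶠ (q ^ i)) t^q≡t) (InSubfield-^q^i t^q≡t i))

  -- Natural multiples m · x.  Translation by x permutes 𝔽, so summing over 𝔽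
  -- shows card · x = 0; hence a field of order p^k has p · 1 = 0.
  listSum : List Carrier → Carrier
  listSum = foldr _+_ 0#

  sum-translate : ∀ x l → listSum (map (x +_) l) ≡ length l · x + listSum l
  sum-translate x [] = sym (+-identityˡ 0#)
  sum-translate x (y ∷ l) = trans (cong ((x + y) +_) (sum-translate x l))
    (solve 4 (λ x y nx s → ((x ⊕ y) ⊕ (nx ⊕ s)) ⊜ ((x ⊕ nx) ⊕ (y ⊕ s))) refl x y (length l · x) (listSum l))

  card·≡0 : ∀ x → card · x ≡ 0#
  card·≡0 x = +-identityˡ-unique (card · x) (listSum elements) (begin
    card · x + listSum elements       ≡⟨ sym (sum-translate x elements) ⟩
    listSum (map (x +_) elements)     ≡⟨ foldr-commMonoid (setoid Carrier) +-isCommutativeMonoid (↭⇒↭ₛ translation-↭) ⟩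
    listSum elements                  ∎)
    where
    translation-↭ : map (x +_) elements ↭ elements
    translation-↭ = map-↭-self elements unique (x +_) (- x +_)
      (λ y → trans (sym (+-assoc (- x) x y)) (trans (cong (_+ y) (-‿inverseˡ x)) (+-identityˡ y)))
      (λ y → trans (sym (+-assoc x (- x) y)) (trans (cong (_+ y) (-‿inverseʳ x)) (+-identityˡ y)))
      (λ {y} _ → complete (x + y)) (λ {z} _ → complete (- x + z))

  -- (p^k) · 1 = (p · 1)^k, so p · 1 = 0 follows from card · 1 = 0 in a domain.
  ·1-^ : ∀ p k → (p ^ k) · 1# ≡ (p · 1#) ^ᶠ k
  ·1-^ p zero = +-identityʳ 1#
  ·1-^ p (suc k) = trans (×1-homo-* p (p ^ k)) (cong ((p · 1#) *_) (·1-^ p k))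

  characteristic : ∀ p k → card ≡ p ^ k → p · 1# ≡ 0#
  characteristic p k card≡p^k = ^ᶠ≡0⇒≡0 (p · 1#) k (begin
    (p · 1#) ^ᶠ k    ≡⟨ sym (·1-^ p k) ⟩
    (p ^ k) · 1#     ≡⟨ cong (_· 1#) (sym card≡p^k) ⟩
    card · 1#        ≡⟨ card·≡0 1# ⟩
    0#               ∎)

  ·-char : ∀ {p} → p · 1# ≡ 0# → ∀ m x → p ∣ m → m · x ≡ 0#
  ·-char {p} p·1≡0 .(d ℕ.* p) x (divides d refl) = begin
    (d ℕ.* p) · x                ≡⟨ cong ((d ℕ.* p) ·_) (sym (*-identityˡ x)) ⟩
    (d ℕ.* p) · (1# * x)         ≡⟨ sym (×-assoc-* (d ℕ.* p) 1# x) ⟩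
    ((d ℕ.* p) · 1#) * x         ≡⟨ cong (_* x) (×1-homo-* d p) ⟩
    ((d · 1#) * (p · 1#)) * x    ≡⟨ cong (λ v → ((d · 1#) * v) * x) p·1≡0 ⟩
    ((d · 1#) * 0#) * x          ≡⟨ cong (_* x) (zeroʳ (d · 1#)) ⟩
    0# * x                       ≡⟨ zeroˡ x ⟩
    0#                           ∎

  Additive : ℕ → Set
  Additive e = ∀ x y → (x + y) ^ᶠ e ≡ x ^ᶠ e + y ^ᶠ e

  -- Frobenius: in characteristic p the binomial theorem collapses to
  -- (x + y)^p = x^p + y^p, since p divides every middle coefficient (p C k).
  frobenius : ∀ {p} → Prime p → p · 1# ≡ 0# → Additive p
  frobenius {zero} ()
  frobenius {suc p′} pr p·1≡0 x y = begin
    (x + y) ^ᶠ p                                               ≡⟨ ^ᶠ≡^ʳ (x + y) p ⟩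
    (x + y) ^ʳ p                                               ≡⟨ binomial-theorem p x y ⟩
    term Fin.zero + sum (λ i → term (Fin.suc i))               ≡⟨ cong (term Fin.zero +_) (sum-init-last (λ i → term (Fin.suc i))) ⟩
    term Fin.zero + (sum middle + term (Fin.suc (fromℕ p′)))  ≡⟨ cong₂ (λ u v → u + (v + term (Fin.suc (fromℕ p′)))) first-term middle-vanishes ⟩
    y ^ᶠ p + (0# + term (Fin.suc (fromℕ p′)))                 ≡⟨ cong (λ v → y ^ᶠ p + (0# + v)) last-term ⟩
    y ^ᶠ p + (0# + x ^ᶠ p)                                     ≡⟨ trans (cong (y ^ᶠ p +_) (+-identityˡ _)) (+-comm _ _) ⟩
    x ^ᶠ p + y ^ᶠ p                                            ∎
    where
    p : ℕ
    p = suc p′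
    term : Fin (suc p) → Carrier
    term = binomialTerm x y p
    middle : Fin p′ → Carrier
    middle i = term (Fin.suc (inject₁ i))

    first-term : term Fin.zero ≡ y ^ᶠ p
    first-term = begin
      (p C 0) · (1# * y ^ʳ p)   ≡⟨ cong (_· (1# * y ^ʳ p)) (trans (nCk≡nC[n∸k] {k = 0} {n = p} z≤n) (nCn≡1 p)) ⟩
      1# * y ^ʳ p + 0#          ≡⟨ trans (+-identityʳ _) (*-identityˡ _) ⟩
      y ^ʳ p                    ≡⟨ sym (^ᶠ≡^ʳ y p) ⟩
      y ^ᶠ p                    ∎

    last-term : term (Fin.suc (fromℕ p′)) ≡ x ^ᶠ p
    last-term = begin
      term (Fin.suc (fromℕ p′))
        ≡⟨ cong (λ k → (p C suc k) · (x ^ʳ suc k * y ^ʳ (p′ ∸ k))) (toℕ-fromℕ p′) ⟩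
      (p C p) · (x ^ʳ p * y ^ʳ (p′ ∸ p′))
        ≡⟨ cong₂ (λ k l → k · (x ^ʳ p * y ^ʳ l)) (nCn≡1 p) (ℕP.n∸n≡0 p′) ⟩
      x ^ʳ p * 1# + 0#          ≡⟨ trans (+-identityʳ _) (*-identityʳ _) ⟩
      x ^ʳ p                    ≡⟨ sym (^ᶠ≡^ʳ x p) ⟩
      x ^ᶠ p                    ∎

    middle-vanishes : sum middle ≡ 0#
    middle-vanishes = trans (sum-cong-≗ vanishes) (sum-replicate-zero p′)
      where
      vanishes : ∀ i → middle i ≡ replicate p′ 0# i
      vanishes i = ·-char p·1≡0 (p C suc (toℕ (inject₁ i))) _
        (prime∣choose pr (s≤s z≤n) (s≤s (subst (_< p′) (sym (toℕ-inject₁ i)) (toℕ<n i))))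

  Additive-^ : ∀ {e} → Additive e → ∀ k → Additive (e ^ k)
  Additive-^ additive zero x y = trans (*-identityʳ _) (sym (cong₂ _+_ (*-identityʳ x) (*-identityʳ y)))
  Additive-^ {e} additive (suc k) x y = begin
    (x + y) ^ᶠ (e ℕ.* e ^ k)                ≡⟨ ^ᶠ-* (x + y) e (e ^ k) ⟩
    ((x + y) ^ᶠ e) ^ᶠ (e ^ k)               ≡⟨ cong (_^ᶠ (e ^ k)) (additive x y) ⟩
    (x ^ᶠ e + y ^ᶠ e) ^ᶠ (e ^ k)            ≡⟨ Additive-^ additive k _ _ ⟩
    (x ^ᶠ e) ^ᶠ (e ^ k) + (y ^ᶠ e) ^ᶠ (e ^ k) ≡⟨ sym (cong₂ _+_ (^ᶠ-* x e (e ^ k)) (^ᶠ-* y e (e ^ k))) ⟩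
    x ^ᶠ (e ℕ.* e ^ k) + y ^ᶠ (e ℕ.* e ^ k) ∎

  Additive-0 : ∀ {e} → Additive e → 0# ^ᶠ e ≡ 0#
  Additive-0 {e} additive = +-identityʳ-unique (0# ^ᶠ e) (0# ^ᶠ e)
    (sym (trans (cong (_^ᶠ e) (sym (+-identityʳ 0#))) (additive 0# 0#)))

  -- Fermat's little theorem x^card = x.  Multiplication by x ≠ 0 permutes the
  -- nonzero elements, so comparing their products gives x^(card − 1) = 1.
  nonzero : List Carrier
  nonzero = filter (λ y → ¬? (y ≟ 0#)) elements

  ∈-nonzero⁻ : ∀ {y} → y ∈ nonzero → y ≢ 0#
  ∈-nonzero⁻ y∈ = proj₂ (∈-filter⁻ (λ y → ¬? (y ≟ 0#)) {xs = elements} y∈)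

  ∈-nonzero⁺ : ∀ {y} → y ≢ 0# → y ∈ nonzero
  ∈-nonzero⁺ {y} y≢0 = ∈-filter⁺ (λ y → ¬? (y ≟ 0#)) (complete y) y≢0

  length-without-0 : ∀ l → Unique l → 0# ∈ l → length l ≡ suc (length (filter (λ y → ¬? (y ≟ 0#)) l))
  length-without-0 (y ∷ l) (y∉l ∷ uniq) 0∈ with y ≟ 0#
  ... | yes refl = cong suc (sym (cong length (filter-all (λ y → ¬? (y ≟ 0#)) (All.map (λ ne e → ne (sym e)) y∉l))))
  ... | no y≢0 with 0∈
  ...   | here 0≡y = ⊥-elim (y≢0 (sym 0≡y))
  ...   | there 0∈l = cong suc (length-without-0 l uniq 0∈l)

  card≡1+|nonzero| : card ≡ suc (length nonzero)
  card≡1+|nonzero| = length-without-0 elements unique (complete 0#)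

  listProduct : List Carrier → Carrier
  listProduct = foldr _*_ 1#

  product-scale : ∀ x l → listProduct (map (x *_) l) ≡ x ^ᶠ length l * listProduct l
  product-scale x [] = sym (*-identityˡ 1#)
  product-scale x (y ∷ l) = trans (cong ((x * y) *_) (product-scale x l))
    (solve 4 (λ x y xⁿ P → ((x ⊗ y) ⊗ (xⁿ ⊗ P)) ⊜ ((x ⊗ xⁿ) ⊗ (y ⊗ P))) refl x y (x ^ᶠ length l) (listProduct l))

  product≢0 : ∀ l → (∀ {y} → y ∈ l → y ≢ 0#) → listProduct l ≢ 0#
  product≢0 [] _ 1≡0 = 0≢1 (sym 1≡0)
  product≢0 (y ∷ l) all≢0 yP≡0 with no-zero-divisors y (listProduct l) yP≡0
  ... | inj₁ y≡0 = all≢0 (here refl) y≡0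
  ... | inj₂ P≡0 = product≢0 l (λ y∈ → all≢0 (there y∈)) P≡0

  fermat-nonzero : ∀ x → x ≢ 0# → x ^ᶠ length nonzero ≡ 1#
  fermat-nonzero x x≢0 = *-cancelˡ P (x ^ᶠ length nonzero) 1# (product≢0 nonzero ∈-nonzero⁻) (begin
    P * x ^ᶠ length nonzero          ≡⟨ *-comm P _ ⟩
    x ^ᶠ length nonzero * P          ≡⟨ sym (product-scale x nonzero) ⟩
    listProduct (map (x *_) nonzero) ≡⟨ foldr-commMonoid (setoid Carrier) *-isCommutativeMonoid (↭⇒↭ₛ scaling-↭) ⟩
    P                                ≡⟨ sym (*-identityʳ P) ⟩
    P * 1#                           ∎)
    where
    P : Carrier
    P = listProduct nonzero
    x⁻¹ : Carrier
    x⁻¹ = proj₁ (inverse x x≢0)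
    xx⁻¹≡1 : x * x⁻¹ ≡ 1#
    xx⁻¹≡1 = proj₂ (inverse x x≢0)
    x⁻¹≢0 : x⁻¹ ≢ 0#
    x⁻¹≢0 x⁻¹≡0 = 0≢1 (trans (sym (zeroʳ x)) (trans (cong (x *_) (sym x⁻¹≡0)) xx⁻¹≡1))
    cancel : ∀ u v → u * v ≡ 1# → ∀ y → v * (u * y) ≡ y
    cancel u v uv≡1 y = trans (sym (*-assoc v u y)) (trans (cong (_* y) (trans (*-comm v u) uv≡1)) (*-identityˡ y))
    scale-closed : ∀ u → u ≢ 0# → ∀ {y} → y ∈ nonzero → u * y ∈ nonzero
    scale-closed u u≢0 {y} y∈ = ∈-nonzero⁺ λ uy≡0 → case-zero (no-zero-divisors u y uy≡0)
      where
      case-zero : u ≡ 0# ⊎ y ≡ 0# → ⊥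
      case-zero (inj₁ u≡0) = u≢0 u≡0
      case-zero (inj₂ y≡0) = ∈-nonzero⁻ y∈ y≡0
    scaling-↭ : map (x *_) nonzero ↭ nonzero
    scaling-↭ = map-↭-self nonzero (UniqueP.filter⁺ (λ y → ¬? (y ≟ 0#)) {elements} unique) (x *_) (x⁻¹ *_)
      (cancel x x⁻¹ xx⁻¹≡1) (cancel x⁻¹ x (trans (*-comm x⁻¹ x) xx⁻¹≡1))
      (scale-closed x x≢0) (scale-closed x⁻¹ x⁻¹≢0)

  ^ᶠ-period : ∀ x k → x ^ᶠ (suc k ℕ.+ length nonzero) ≡ x ^ᶠ suc k
  ^ᶠ-period x k with x ≟ 0#
  ... | yes refl = trans (zeroˡ _) (sym (zeroˡ _))
  ... | no x≢0 = begin
    x * x ^ᶠ (k ℕ.+ length nonzero)       ≡⟨ cong (x *_) (^ᶠ-+ x k (length nonzero)) ⟩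
    x * (x ^ᶠ k * x ^ᶠ length nonzero)    ≡⟨ cong (λ v → x * (x ^ᶠ k * v)) (fermat-nonzero x x≢0) ⟩
    x * (x ^ᶠ k * 1#)                     ≡⟨ cong (x *_) (*-identityʳ _) ⟩
    x * x ^ᶠ k                            ∎

  fermat : ∀ x → x ^ᶠ card ≡ x
  fermat x = trans (cong (x ^ᶠ_) card≡1+|nonzero|) (trans (^ᶠ-period x 0) (*-identityʳ x))

  -- Norm-type powers lie in 𝔽_q: if e·(q − 1) = card − 1 then e·q = e + (card − 1),
  -- so (z^e)^q = z^e.
  norm-in-subfield : ∀ q e → 0 < q → e ℕ.* (q ∸ 1) ≡ card ∸ 1 → ∀ z → InSubfield q (z ^ᶠ e)
  norm-in-subfield q zero _ _ z = 1^ᶠ q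
  norm-in-subfield (suc q′) (suc e′) _ e[q-1]≡card-1 z = begin
    (z ^ᶠ suc e′) ^ᶠ suc q′            ≡⟨ sym (^ᶠ-* z (suc e′) (suc q′)) ⟩
    z ^ᶠ (suc e′ ℕ.* suc q′)           ≡⟨ cong (z ^ᶠ_) exponent ⟩
    z ^ᶠ (suc e′ ℕ.+ length nonzero)   ≡⟨ ^ᶠ-period z e′ ⟩
    z ^ᶠ suc e′                        ∎
    where
    exponent : suc e′ ℕ.* suc q′ ≡ suc e′ ℕ.+ length nonzero
    exponent = trans (ℕP.*-suc (suc e′) q′)
      (cong (suc e′ ℕ.+_) (trans e[q-1]≡card-1 (cong (_∸ 1) card≡1+|nonzero|)))

  -- A function with at most one solution x of f(x + a) − c·f(x) = β, for all a and β,
  -- is PcN: every entry cΔ_f(a, β) counts a duplicate-free list of equal elements.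
  PcN-from-uniqueness : ∀ f c →
    (∀ a β x y → f (x + a) - c * f x ≡ β → f (y + a) - c * f y ≡ β → x ≡ y) → PcN f c
  PcN-from-uniqueness f c unique-solution =
    foldr-⊔≤1 (concatMap (rowValues f c) elements) (AllP.concat⁺ (AllP.map⁺ {xs = elements} (All.tabulate (λ {a} _ → row a))))
    where
    foldr-⊔≤1 : ∀ ns → All (_≤ 1) ns → foldr _⊔_ 0 ns ≤ 1
    foldr-⊔≤1 [] [] = z≤n
    foldr-⊔≤1 (n ∷ ns) (n≤1 ∷ ns≤1) = ℕP.⊔-lub n≤1 (foldr-⊔≤1 ns ns≤1)
    entry : ∀ a β → cΔ f c a β ≤ 1
    entry a β = length≤1 _ (UniqueP.filter⁺ is-solution? {elements} unique)
      (λ x∈ y∈ → unique-solution a β _ _ (solves x∈) (solves y∈))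
      where
      is-solution? : ∀ x → Dec (f (x + a) - c * f x ≡ β)
      is-solution? x = (f (x + a) - c * f x) ≟ β
      solves : ∀ {x} → x ∈ filter is-solution? elements → f (x + a) - c * f x ≡ β
      solves {x} x∈ = proj₂ (∈-filter⁻ is-solution? {x} {xs = elements} x∈)
    row : ∀ a → All (_≤ 1) (rowValues f c a)
    row a with ¬? ((a ≟ 0#) ×-dec (c ≟ 1#))
    ... | yes _ = AllP.map⁺ {xs = elements} (All.tabulate (λ {β} _ → entry a β))
    ... | no _ = []

  -- From now on x ↦ x^q is additive (q a power of the characteristic).
  module OverSubfield (q : ℕ) (frobenius-q : Additive q) where

    lin-additive : ∀ i as x y → linEvalFrom q i as (x + y) ≡ linEvalFrom q i as x + linEvalFrom q i as y
    lin-additive i [] x y = sym (+-identityˡ 0#)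
    lin-additive i (a ∷ as) x y = begin
      a * (x + y) ^ᶠ (q ^ i) + linEvalFrom q (suc i) as (x + y)
        ≡⟨ cong₂ _+_ (trans (cong (a *_) (Additive-^ frobenius-q i x y)) (distribˡ a _ _)) (lin-additive (suc i) as x y) ⟩
      (a * x ^ᶠ (q ^ i) + a * y ^ᶠ (q ^ i)) + (linEvalFrom q (suc i) as x + linEvalFrom q (suc i) as y)
        ≡⟨ solve 4 (λ A B C D → ((A ⊕ B) ⊕ (C ⊕ D)) ⊜ ((A ⊕ C) ⊕ (B ⊕ D))) refl _ _ _ _ ⟩
      (a * x ^ᶠ (q ^ i) + linEvalFrom q (suc i) as x) + (a * y ^ᶠ (q ^ i) + linEvalFrom q (suc i) as y) ∎

    lin-frobenius : ∀ i as → All (InSubfield q) as → ∀ x → linEvalFrom q i as x ^ᶠ q ≡ linEvalFrom q i as (x ^ᶠ q)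
    lin-frobenius i [] [] x = Additive-0 {q} frobenius-q
    lin-frobenius i (a ∷ as) (a∈ ∷ as∈) x = begin
      (a * x ^ᶠ (q ^ i) + linEvalFrom q (suc i) as x) ^ᶠ q
        ≡⟨ frobenius-q _ _ ⟩
      (a * x ^ᶠ (q ^ i)) ^ᶠ q + linEvalFrom q (suc i) as x ^ᶠ q
        ≡⟨ cong₂ _+_ (*-^ᶠ a _ q) (lin-frobenius (suc i) as as∈ x) ⟩
      a ^ᶠ q * (x ^ᶠ (q ^ i)) ^ᶠ q + linEvalFrom q (suc i) as (x ^ᶠ q)
        ≡⟨ cong (_+ linEvalFrom q (suc i) as (x ^ᶠ q)) (cong₂ _*_ a∈ powers-commute) ⟩
      a * (x ^ᶠ q) ^ᶠ (q ^ i) + linEvalFrom q (suc i) as (x ^ᶠ q) ∎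
      where
      powers-commute : (x ^ᶠ (q ^ i)) ^ᶠ q ≡ (x ^ᶠ q) ^ᶠ (q ^ i)
      powers-commute = trans (sym (^ᶠ-* x (q ^ i) q)) (trans (cong (x ^ᶠ_) (ℕP.*-comm (q ^ i) q)) (^ᶠ-* x q (q ^ i)))

    lin-scalar : ∀ i as t → InSubfield q t → linEvalFrom q i as t ≡ t * linEvalFrom q i as 1#
    lin-scalar i [] t _ = sym (zeroʳ t)
    lin-scalar i (a ∷ as) t t∈ = begin
      a * t ^ᶠ (q ^ i) + linEvalFrom q (suc i) as t
        ≡⟨ cong₂ _+_ (cong (a *_) (trans (InSubfield-^q^i t∈ i) (sym (*-identityʳ t)))) (lin-scalar (suc i) as t t∈) ⟩
      a * (t * 1#) + t * linEvalFrom q (suc i) as 1#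
        ≡⟨ cong (λ v → a * (t * v) + t * linEvalFrom q (suc i) as 1#) (sym (1^ᶠ (q ^ i))) ⟩
      a * (t * 1# ^ᶠ (q ^ i)) + t * linEvalFrom q (suc i) as 1#
        ≡⟨ solve 4 (λ a t u R → ((a ⊗ (t ⊗ u)) ⊕ (t ⊗ R)) ⊜ (t ⊗ ((a ⊗ u) ⊕ R))) refl a t _ _ ⟩
      t * (a * 1# ^ᶠ (q ^ i) + linEvalFrom q (suc i) as 1#) ∎

    -- Tr(y)^q = Tr(y) + y^(q^n) − y, and y^(q^n) = y when card = q^n.
    trace-step : ∀ i y → Tr q i y ^ᶠ q + y ≡ Tr q i y + y ^ᶠ (q ^ i)
    trace-step zero y = trans (cong (_+ y) (Additive-0 {q} frobenius-q)) (cong (0# +_) (sym (*-identityʳ y)))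
    trace-step (suc i) y = begin
      (Tr q i y + y ^ᶠ (q ^ i)) ^ᶠ q + y           ≡⟨ cong (_+ y) (frobenius-q _ _) ⟩
      (Tr q i y ^ᶠ q + (y ^ᶠ (q ^ i)) ^ᶠ q) + y    ≡⟨ solve 3 (λ T Y y → ((T ⊕ Y) ⊕ y) ⊜ ((T ⊕ y) ⊕ Y)) refl _ _ y ⟩
      (Tr q i y ^ᶠ q + y) + (y ^ᶠ (q ^ i)) ^ᶠ q    ≡⟨ cong₂ _+_ (trace-step i y) next-power ⟩
      (Tr q i y + y ^ᶠ (q ^ i)) + y ^ᶠ (q ^ suc i) ∎
      where
      next-power : (y ^ᶠ (q ^ i)) ^ᶠ q ≡ y ^ᶠ (q ^ suc i)
      next-power = trans (sym (^ᶠ-* y (q ^ i) q)) (cong (y ^ᶠ_) (ℕP.*-comm (q ^ i) q))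

    trace-in-subfield : ∀ n → card ≡ q ^ n → ∀ y → InSubfield q (Tr q n y)
    trace-in-subfield n card≡q^n y = +-cancelʳ y _ _ (begin
      Tr q n y ^ᶠ q + y          ≡⟨ trace-step n y ⟩
      Tr q n y + y ^ᶠ (q ^ n)    ≡⟨ cong (λ k → Tr q n y + y ^ᶠ k) (sym card≡q^n) ⟩
      Tr q n y + y ^ᶠ card       ≡⟨ cong (Tr q n y +_) (fermat y) ⟩
      Tr q n y + y               ∎)

    L : Carrier → Carrier
    L z = z ^ᶠ q - z

    L-additive : ∀ z w → L (z + w) ≡ L z + L w
    L-additive z w = trans (cong (_- (z + w)) (frobenius-q z w))
      (solve 4 (λ A B z w → ((A ⊕ B) ⊕ (⊝ (z ⊕ w))) ⊜ ((A ⊕ (⊝ z)) ⊕ (B ⊕ (⊝ w)))) refl _ _ z w)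

    L-scalar : ∀ c z → InSubfield q c → L (c * z) ≡ c * L z
    L-scalar c z c∈ = begin
      (c * z) ^ᶠ q - c * z    ≡⟨ cong (_- (c * z)) (trans (*-^ᶠ c z q) (cong (_* z ^ᶠ q) c∈)) ⟩
      c * z ^ᶠ q - c * z      ≡⟨ sym (x[y-z]≈xy-xz c (z ^ᶠ q) z) ⟩
      c * L z                 ∎

    L-subfield : ∀ t → InSubfield q t → L t ≡ 0#
    L-subfield t t∈ = trans (cong (_- t) t∈) (-‿inverseʳ t)

    L-periodic : ∀ x t → InSubfield q t → L (x + t) ≡ L x
    L-periodic x t t∈ = trans (L-additive x t) (trans (cong (L x +_) (L-subfield t t∈)) (+-identityʳ (L x)))

    L-equal⇒difference-in-subfield : ∀ z w → L z ≡ L w → InSubfield q (z - w)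
    L-equal⇒difference-in-subfield z w Lz≡Lw = x-y≡0⇒x≡y _ _ (+-identityˡ-unique (L (z - w)) (L w) (begin
      L (z - w) + L w    ≡⟨ sym (L-additive (z - w) w) ⟩
      L ((z - w) + w)    ≡⟨ cong L (sub-add z w) ⟩
      L z                ≡⟨ Lz≡Lw ⟩
      L w                ∎))

    module Uniqueness
      (b : Carrier) (b∈ : InSubfield q b)
      (as : List Carrier) (as∈ : All (InSubfield q) as)
      (H : Carrier → Carrier) (H∈ : ∀ x → InSubfield q (H x))
      (H-periodic : ∀ x t → InSubfield q t → H (x + t) ≡ H x)
      (f-injective : ∀ {x y} → b * linEval q as x + H x ≡ b * linEval q as y + H y → x ≡ y)
      where

      φ : Carrier → Carrier
      φ = linEval q as

      f : Carrier → Carrier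
      f x = b * φ x + H x

      -- L kills H, so L ∘ f = L ∘ (b·φ), which is additive.
      L∘f-shift : ∀ u a → L (f (u + a)) ≡ L (f u) + L (b * φ a)
      L∘f-shift u a = begin
        L (f (u + a))                        ≡⟨ L∘f (u + a) ⟩
        L (b * φ (u + a))                    ≡⟨ cong (λ v → L (b * v)) (lin-additive 0 as u a) ⟩
        L (b * (φ u + φ a))                  ≡⟨ cong L (distribˡ b (φ u) (φ a)) ⟩
        L (b * φ u + b * φ a)                ≡⟨ L-additive (b * φ u) (b * φ a) ⟩
        L (b * φ u) + L (b * φ a)            ≡⟨ cong (_+ L (b * φ a)) (sym (L∘f u)) ⟩
        L (f u) + L (b * φ a)                ∎
        where
        L∘f : ∀ u → L (f u) ≡ L (b * φ u)
        L∘f u = trans (L-additive (b * φ u) (H u))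
          (trans (cong (L (b * φ u) +_) (L-subfield (H u) (H∈ u))) (+-identityʳ _))

      s : Carrier
      s = b * φ 1#

      f-translate : ∀ u t → InSubfield q t → f (u + t) ≡ f u + t * s
      f-translate u t t∈ = begin
        b * φ (u + t) + H (u + t)    ≡⟨ cong₂ _+_ (cong (b *_) (trans (lin-additive 0 as u t) (cong (φ u +_) (lin-scalar 0 as t t∈)))) (H-periodic u t t∈) ⟩
        b * (φ u + t * φ 1#) + H u   ≡⟨ solve 5 (λ b P t Q h → ((b ⊗ (P ⊕ (t ⊗ Q))) ⊕ h) ⊜ (((b ⊗ P) ⊕ h) ⊕ (t ⊗ (b ⊗ Q)))) refl b _ t _ _ ⟩
        f u + t * s                  ∎

      s∈ : InSubfield q s
      s∈ = InSubfield-* {q} b∈ (trans (lin-frobenius 0 as as∈ 1#) (cong φ (1^ᶠ q)))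

      s≢0 : s ≢ 0#
      s≢0 s≡0 = 0≢1 (sym (trans (sym (+-identityˡ 1#)) (f-injective (begin
        f (0# + 1#)      ≡⟨ f-translate 0# 1# (InSubfield-1 q) ⟩
        f 0# + 1# * s    ≡⟨ cong (λ v → f 0# + 1# * v) s≡0 ⟩
        f 0# + 1# * 0#   ≡⟨ trans (cong (f 0# +_) (zeroʳ 1#)) (+-identityʳ _) ⟩
        f 0#             ∎))))

      s⁻¹ : Carrier
      s⁻¹ = proj₁ (inverse s s≢0)

      ss⁻¹≡1 : s * s⁻¹ ≡ 1#
      ss⁻¹≡1 = proj₂ (inverse s s≢0)

      module _ (c : Carrier) (c∈ : InSubfield q c) (c≢1 : c ≢ 1#) (a β : Carrier) where

        Solution : Carrier → Set
        Solution x = f (x + a) - c * f x ≡ β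

        -- Applying L to f(u + a) = β + c·f(u) gives (1 − c)·L(f u) = L β − L(b·φ(a)),
        -- whose right side does not depend on the solution u.
        one-minus-c-relation : ∀ u → Solution u → L (f u) - c * L (f u) ≡ L β - L (b * φ a)
        one-minus-c-relation u sol = begin
          X - c * X                   ≡⟨ sym (add-sub-cancelʳ X (c * X) A) ⟩
          (X + A) - (c * X + A)       ≡⟨ cong₂ _-_ X+A≡Lβ+cX (+-comm (c * X) A) ⟩
          (L β + c * X) - (A + c * X) ≡⟨ add-sub-cancelʳ (L β) A (c * X) ⟩
          L β - A                  ∎
          where
          X A : Carrier
          X = L (f u)
          A = L (b * φ a)
          X+A≡Lβ+cX : X + A ≡ L β + c * X
          X+A≡Lβ+cX = begin
            X + A                       ≡⟨ sym (L∘f-shift u a) ⟩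
            L (f (u + a))               ≡⟨ cong L (sym (sub-add (f (u + a)) (c * f u))) ⟩
            L (f (u + a) - c * f u + c * f u) ≡⟨ cong (λ v → L (v + c * f u)) sol ⟩
            L (β + c * f u)             ≡⟨ L-additive β (c * f u) ⟩
            L β + L (c * f u)           ≡⟨ cong (L β +_) (L-scalar c (f u) c∈) ⟩
            L β + c * X                 ∎

        solutions-differ-in-subfield : ∀ x y → Solution x → Solution y → InSubfield q (f x - f y)
        solutions-differ-in-subfield x y sol-x sol-y = L-equal⇒difference-in-subfield (f x) (f y)
          (one-minus-injective c (L (f x)) (L (f y)) c≢1
            (trans (one-minus-c-relation x sol-x) (sym (one-minus-c-relation y sol-y))))

        -- With D = f x − f y ∈ 𝔽_q we get x = y + D/s, hence f(x + a) = f(y + a) + D;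
        -- substituting into the equation for x leaves (1 − c)·D = 0.
        unique-solution : ∀ x y → Solution x → Solution y → x ≡ y
        unique-solution x y sol-x sol-y = f-injective (x-y≡0⇒x≡y (f x) (f y) D≡0)
          where
          D t : Carrier
          D = f x - f y
          t = D * s⁻¹
          t∈ : InSubfield q t
          t∈ = InSubfield-* {q} (solutions-differ-in-subfield x y sol-x sol-y) (InSubfield-inverse {q} s∈ ss⁻¹≡1)
          t*s≡D : t * s ≡ D
          t*s≡D = trans (*-assoc D s⁻¹ s) (trans (cong (D *_) (trans (*-comm s⁻¹ s) ss⁻¹≡1)) (*-identityʳ D))
          f-shift-by-D : ∀ u → f (u + t) ≡ f u + D
          f-shift-by-D u = trans (f-translate u t t∈) (cong (f u +_) t*s≡D)
          fx≡fy+D : f x ≡ f y + D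
          fx≡fy+D = trans (sym (sub-add (f x) (f y))) (+-comm D (f y))
          y+t≡x : y + t ≡ x
          y+t≡x = f-injective (trans (f-shift-by-D y) (sym fx≡fy+D))
          f[x+a]≡f[y+a]+D : f (x + a) ≡ f (y + a) + D
          f[x+a]≡f[y+a]+D = begin
            f (x + a)          ≡⟨ cong (λ v → f (v + a)) (sym y+t≡x) ⟩
            f ((y + t) + a)    ≡⟨ cong f (solve 3 (λ y t a → ((y ⊕ t) ⊕ a) ⊜ ((y ⊕ a) ⊕ t)) refl y t a) ⟩
            f ((y + a) + t)    ≡⟨ f-shift-by-D (y + a) ⟩
            f (y + a) + D      ∎
          D≡0 : D ≡ 0#
          D≡0 = one-minus-zero c D c≢1 (+-identityʳ-unique β (D - c * D) (begin
            β + (D - c * D)                                ≡⟨ cong (_+ (D - c * D)) (sym sol-y) ⟩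
            (f (y + a) - c * f y) + (D - c * D)            ≡⟨ solve 4 (λ F D C E → ((F ⊕ (⊝ C)) ⊕ (D ⊕ (⊝ E))) ⊜ ((F ⊕ D) ⊕ (⊝ (C ⊕ E)))) refl (f (y + a)) D (c * f y) (c * D) ⟩
            (f (y + a) + D) - (c * f y + c * D)            ≡⟨ cong₂ _-_ (sym f[x+a]≡f[y+a]+D) (trans (sym (distribˡ c (f y) D)) (cong (c *_) (sym fx≡fy+D))) ⟩
            f (x + a) - c * f x                            ≡⟨ sol-x ⟩
            β                                              ∎))

    -- The uniqueness lemma applied to H = h ∘ L, which is automatically 𝔽_q-periodic:
    -- if x ↦ b·φ(x) + h(x^q − x) permutes 𝔽 and h takes values in 𝔽_q, it is PcN
    -- for every c ∈ 𝔽_q ∖ {1}.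
    PcN-of-permutation : ∀ b → InSubfield q b → ∀ as → All (InSubfield q) as →
      ∀ (h : Carrier → Carrier) → (∀ z → InSubfield q (h z)) →
      Bijective _≡_ _≡_ (λ x → b * linEval q as x + h (L x)) →
      ∀ c → InSubfield q c → c ≢ 1# → PcN (λ x → b * linEval q as x + h (L x)) c
    PcN-of-permutation b b∈ as as∈ h h∈ (f-injective , _) c c∈ c≢1 =
      PcN-from-uniqueness _ c (Uniqueness.unique-solution b b∈ as as∈ (λ x → h (L x)) (λ x → h∈ (L x))
        (λ x t t∈ → cong h (L-periodic x t t∈)) f-injective c c∈ c≢1)

-- f₁ and f₂ are both of the form b·φ(x) + h(x^q − x), with h = Tr ∘ g resp. h = g^e
-- taking values in 𝔽_q; x ↦ x^q is additive because q is a power of the characteristic.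
theorem3p5 : (F : FiniteField) → let open FiniteField F in
    (p m n q : ℕ) → Prime p → m ≥ 1 → n ≥ 1 → q ≡ p ^ m →
    card ≡ q ^ n →
    (a : List Carrier) → All (InSubfield q) a →
    (g : List Carrier) →
    (b : Carrier) → InSubfield q b → b ≢ 0# →
    (e : ℕ) → e ℕ.* (q ℕ.∸ 1) ≡ q ^ n ℕ.∸ 1 →
    (Bijective _≡_ _≡_ (λ x → b * linEval q a x + Tr q n (polyEval g (x ^ᶠ q - x)))
    → ∀ c → InSubfield q c → c ≢ 1#
    → PcN (λ x → b * linEval q a x + Tr q n (polyEval g (x ^ᶠ q - x))) c)
    ×
    (Bijective _≡_ _≡_ (λ x → b * linEval q a x + polyEval g (x ^ᶠ q - x) ^ᶠ e)
    → ∀ c → InSubfield q c → c ≢ 1#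
    → PcN (λ x → b * linEval q a x + polyEval g (x ^ᶠ q - x) ^ᶠ e) c)
theorem3p5 F p m n q prime-p _ _ q≡p^m card≡q^n a a∈ g b b∈ _ e e[q-1]≡q^n-1 =
    PcN-of-permutation b b∈ a a∈ (λ z → Tr q n (polyEval g z)) (λ z → trace-in-subfield n card≡q^n (polyEval g z))
  , PcN-of-permutation b b∈ a a∈ (λ z → polyEval g z ^ᶠ e) (λ z → norm-in-subfield q e 0<q e[q-1]≡card-1 (polyEval g z))
  where
  open FiniteField F
  open FieldTheory F

  card≡p^mn : card ≡ p ^ (m ℕ.* n)
  card≡p^mn = trans card≡q^n (trans (cong (_^ n) q≡p^m) (ℕP.^-*-assoc p m n))

  frobenius-q : Additive q
  frobenius-q = subst Additive (sym q≡p^m) (Additive-^ (frobenius prime-p (characteristic p (m ℕ.* n) card≡p^mn)) m)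

  open OverSubfield q frobenius-q

  0<q : 0 < q
  0<q = subst (0 <_) (sym q≡p^m) (ℕP.m^n>0 p {{prime⇒nonZero prime-p}} m)

  e[q-1]≡card-1 : e ℕ.* (q ∸ 1) ≡ card ∸ 1
  e[q-1]≡card-1 = trans e[q-1]≡q^n-1 (cong (_∸ 1) (sym card≡q^n))
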